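{- For $n\geq 1$, \[ B_n(q,t) := \prod_{i=1}^{n}\bigl(1 + t[2i]_q - t\bigr) = \sum_{w\in B_n} q^{\operatorname{inv}_B(w)} t^{\operatorname{m}_B(w)}, \] where $[k]_q=1+q+\cdots+q^{k-1}$.
   Context: $B_n$ is the group of signed permutations: bijections $w$ of $\{\pm1,\ldots,\pm n\}$ with $w(-i)=-w(i)$, written $w=w_1\cdots w_n$ with $w_i=w(i)$. $N(w)$ is the number of $i\in\{1,\ldots,n\}$ with $w_i<0$. The type B inversion number is $\operatorname{inv}_B(w) = |\{1\le i<j\le n : w(i)>w(j)\}| + |\{1\le i<j\le n : -w(i)>w(j)\}| + N(w)$. The statistic $\operatorname{m}_B$ is $\operatorname{m}_B(w)=|\{ i\in\{1,\ldots,n\} : w_i > |w_j| \text{ for some } j>i\}| + N(w)$. -}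

module Defs where

open import Level using (Level)
open import Data.Nat as ℕ using (ℕ; zero; suc)
open import Data.Integer as ℤ using (ℤ; ∣_∣; -_; +_)
open import Data.Fin using (Fin; toℕ)
open import Data.Fin.Properties using ()
open import Data.Vec using (Vec; lookup)
open import Data.List using (List; allFin; map; filter; length; upTo; foldr)
open import Data.List.Relation.Unary.Any using (any?)
open import Data.Product using (_×_)
open import Relation.Nullary using (Dec; yes; no)
open import Relation.Nullary.Decidable using (_×-dec_)
open import Relation.Binary.PropositionalEquality using (_≡_)
open import Algebra.Bundles using (CommutativeRing)

-- A map {±1..±n} → {±1..±n} with w(-i) = -w(i) is determined by w_1..w_n;
-- it is a bijection iff every w_i ∈ {±1,…,±n} and i ↦ |w_i| is injective.
IsSignedPerm : {n : ℕ} → Vec ℤ n → Set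
IsSignedPerm {n} w =
  ((i : Fin n) → (1 ℕ.≤ ∣ lookup w i ∣) × (∣ lookup w i ∣ ℕ.≤ n)) ×
  ((i j : Fin n) → ∣ lookup w i ∣ ≡ ∣ lookup w j ∣ → i ≡ j)

negCount : {n : ℕ} → Vec ℤ n → ℕ
negCount {n} w = length (filter (λ i → lookup w i ℤ.<? + 0) (allFin n))

pairCount : {n : ℕ} → (P : Fin n → Fin n → Set) → (∀ i j → Dec (P i j)) → ℕ
pairCount {n} P P? =
  length (filter (λ ij → P? (Data.Product.proj₁ ij) (Data.Product.proj₂ ij))
    (Data.List.cartesianProduct
      (allFin n) (allFin n)))

invB : {n : ℕ} → Vec ℤ n → ℕ
invB {n} w =
  pairCount (λ i j → (toℕ i ℕ.< toℕ j) × (lookup w j ℤ.< lookup w i))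
            (λ i j → (toℕ i ℕ.<? toℕ j) ×-dec (lookup w j ℤ.<? lookup w i))
  ℕ.+
  pairCount (λ i j → (toℕ i ℕ.< toℕ j) × (lookup w j ℤ.< - lookup w i))
            (λ i j → (toℕ i ℕ.<? toℕ j) ×-dec (lookup w j ℤ.<? - lookup w i))
  ℕ.+ negCount w

mB : {n : ℕ} → Vec ℤ n → ℕ
mB {n} w =
  length (filter
    (λ i → any? (λ j → (toℕ i ℕ.<? toℕ j) ×-dec (+ ∣ lookup w j ∣ ℤ.<? lookup w i))
                (allFin n))
    (allFin n))
  ℕ.+ negCount w

module _ {c ℓ : Level} (R : CommutativeRing c ℓ) where
  open CommutativeRing R

  pow : Carrier → ℕ → Carrier
  pow x zero = 1#
  pow x (suc k) = x * pow x k

  sumR : List Carrier → Carrier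
  sumR = foldr _+_ 0#

  prodR : List Carrier → Carrier
  prodR = foldr _*_ 1#

  qInt : Carrier → ℕ → Carrier
  qInt q k = sumR (map (pow q) (upTo k))

  Bpoly : ℕ → Carrier → Carrier → Carrier
  Bpoly n q t = prodR (map (λ i → (1# + t * qInt q (2 ℕ.* suc i)) - t) (upTo n))

-- Every signed permutation of length n + 1 arises exactly once from one of length n by inserting
-- +(n + 1) or −(n + 1) at one of the n + 1 positions; deleting the entry of absolute value n + 1 undoes
-- this. Inserting +(n + 1) at position i (counted from 0) adds n − i to inv_B, and adds 1 to m_B unless
-- i = n; inserting −(n + 1) adds n + 1 + i to inv_B and 1 to m_B. So each step multiplies the generating
-- function by Σᵢ q^(n−i) t^[i<n] + t Σᵢ q^(n+1+i) = 1 + t (q + ⋯ + q^(2n+1)) = 1 + t [2n+2]_q − t.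

module Submission where

open import Defs
open import Level using (Level)
open import Data.Nat as ℕ using (ℕ; zero; suc; _≥_; _∸_; z≤n; s≤s)
import Data.Nat.Properties as ℕP
open import Data.Integer as ℤ using (ℤ; ∣_∣; -[1+_])
open import Data.Fin as Fin using (Fin; toℕ; punchIn; punchOut)
import Data.Fin.Properties as FinP
open import Data.Vec using (Vec; []; _∷_; lookup; insertAt; removeAt)
import Data.Vec.Properties as VecP
open import Data.Vec.Relation.Unary.All using (All)
open import Data.Vec.Relation.Unary.All.Properties using (lookup⁺; lookup⁻)
open import Data.List as List using (List; []; _∷_; _++_; map; allFin; upTo; applyUpTo; tabulate; cartesianProduct)
import Data.List.Properties as ListP
open import Data.List.Membership.Propositional using (_∈_)
import Data.List.Membership.Propositional.Properties as ∈P
open import Data.List.Membership.Propositional.Properties.WithK using (unique∧set⇒bag)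
open import Data.List.Relation.Unary.Any using (here; there)
open import Data.List.Relation.Unary.All using ([]; _∷_)
open import Data.List.Relation.Unary.Unique.Propositional using (Unique; []; _∷_)
import Data.List.Relation.Unary.Unique.Propositional.Properties as UniqueP
open import Data.List.Relation.Binary.BagAndSetEquality using (∼bag⇒↭)
open import Data.List.Relation.Binary.Permutation.Propositional using (_↭_; ↭-sym; ↭⇒↭ₛ′)
import Data.List.Relation.Binary.Permutation.Propositional.Properties as ↭P
open import Data.List.Relation.Binary.Permutation.Setoid.Properties using (foldr-commMonoid)
open import Data.Bool using (Bool; true; false)
open import Data.Product using (Σ; ∃₂; _×_; _,_; proj₁; proj₂)
open import Data.Unit using (⊤; tt)
open import Data.Empty using (⊥-elim)
open import Data.Maybe using (nothing)
open import Relation.Nullary using (¬_; yes; no)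
open import Relation.Binary.PropositionalEquality as ≡ using (_≡_; _≢_)
import Relation.Binary.Reasoning.Setoid as ≈-Reasoning
open import Function using (_∘_)
open import Function.Bundles using (_⇔_; mk⇔; Equivalence)
open import Algebra.Bundles using (CommutativeRing)
open import Tactic.RingSolver.Core.AlmostCommutativeRing using (fromCommutativeRing)

module Statistics where
  open import Data.Nat using (_+_; _*_)
  open import Data.Nat.Properties using (+-assoc; +-comm; *-suc)
  open import Data.Nat.ListAction using (sum)
  open import Data.Nat.Tactic.RingSolver using (solve-∀)
  open import Algebra.Properties.CommutativeSemigroup ℕP.+-commutativeSemigroup using (x∙yz≈y∙xz)
  open import Data.Integer using (-_)
  import Data.Integer.Properties as ℤP
  open import Data.Fin using () renaming (zero to fz; suc to fs)
  open import Data.List using (filter; length)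
  open import Data.List.Relation.Unary.Any using (any?)
  open import Data.Vec.Relation.Unary.All as All using ([]; _∷_)
  open import Data.Bool using (_∧_; _∨_)
  open import Data.Bool.ListAction using (any)
  open import Data.Bool.Properties using (∨-assoc; ∨-comm)
  open import Relation.Nullary using (Dec; does)
  open import Relation.Nullary.Decidable using (_×-dec_; dec-true; dec-false)
  open ≡ using (refl; sym; trans; cong; cong₂; subst; module ≡-Reasoning)

  𝟙 : Bool → ℕ
  𝟙 true = 1
  𝟙 false = 0

  countᴸ : {A : Set} → (A → Bool) → List A → ℕ
  countᴸ p [] = 0
  countᴸ p (x ∷ xs) = 𝟙 (p x) + countᴸ p xs

  length-filter≡countᴸ : {A : Set} {P : A → Set} (P? : ∀ x → Dec (P x)) (xs : List A) →
    length (filter P? xs) ≡ countᴸ (does ∘ P?) xs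
  length-filter≡countᴸ P? [] = refl
  length-filter≡countᴸ P? (x ∷ xs) with does (P? x)
  ... | true = cong suc (length-filter≡countᴸ P? xs)
  ... | false = length-filter≡countᴸ P? xs

  does-any? : {A : Set} {P : A → Set} (P? : ∀ x → Dec (P x)) (xs : List A) →
    does (any? P? xs) ≡ any (does ∘ P?) xs
  does-any? P? [] = refl
  does-any? P? (x ∷ xs) = cong (does (P? x) ∨_) (does-any? P? xs)

  countᴸ-++ : {A : Set} (p : A → Bool) (xs ys : List A) → countᴸ p (xs ++ ys) ≡ countᴸ p xs + countᴸ p ys
  countᴸ-++ p [] ys = refl
  countᴸ-++ p (x ∷ xs) ys = trans (cong (𝟙 (p x) +_) (countᴸ-++ p xs ys)) (sym (+-assoc (𝟙 (p x)) _ _))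

  countᴸ-map : {A B : Set} (p : B → Bool) (f : A → B) (xs : List A) → countᴸ p (map f xs) ≡ countᴸ (p ∘ f) xs
  countᴸ-map p f [] = refl
  countᴸ-map p f (x ∷ xs) = cong (𝟙 (p (f x)) +_) (countᴸ-map p f xs)

  countᴸ-cartesianProduct : {A B : Set} (p : A × B → Bool) (xs : List A) (ys : List B) →
    countᴸ p (cartesianProduct xs ys) ≡ sum (map (λ x → countᴸ (p ∘ (x ,_)) ys) xs)
  countᴸ-cartesianProduct p [] ys = refl
  countᴸ-cartesianProduct p (x ∷ xs) ys = trans (countᴸ-++ p (map (x ,_) ys) (cartesianProduct xs ys))
    (cong₂ _+_ (countᴸ-map p (x ,_) ys) (countᴸ-cartesianProduct p xs ys))

  countᶠ : {n : ℕ} → (Fin n → Bool) → ℕ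
  countᶠ {zero} p = 0
  countᶠ {suc n} p = 𝟙 (p fz) + countᶠ (p ∘ fs)

  anyᶠ : {n : ℕ} → (Fin n → Bool) → Bool
  anyᶠ {zero} p = false
  anyᶠ {suc n} p = p fz ∨ anyᶠ (p ∘ fs)

  sumᶠ : {n : ℕ} → (Fin n → ℕ) → ℕ
  sumᶠ {zero} f = 0
  sumᶠ {suc n} f = f fz + sumᶠ (f ∘ fs)

  countᴸ-tabulate : {A : Set} {n : ℕ} (p : A → Bool) (f : Fin n → A) → countᴸ p (tabulate f) ≡ countᶠ (p ∘ f)
  countᴸ-tabulate {n = zero} p f = refl
  countᴸ-tabulate {n = suc n} p f = cong (𝟙 (p (f fz)) +_) (countᴸ-tabulate p (f ∘ fs))

  any-tabulate : {A : Set} {n : ℕ} (p : A → Bool) (f : Fin n → A) → any p (tabulate f) ≡ anyᶠ (p ∘ f)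
  any-tabulate {n = zero} p f = refl
  any-tabulate {n = suc n} p f = cong (p (f fz) ∨_) (any-tabulate p (f ∘ fs))

  sum-map-tabulate : {A : Set} {n : ℕ} (g : A → ℕ) (f : Fin n → A) → sum (map g (tabulate f)) ≡ sumᶠ (g ∘ f)
  sum-map-tabulate {n = zero} g f = refl
  sum-map-tabulate {n = suc n} g f = cong (g (f fz) +_) (sum-map-tabulate g (f ∘ fs))

  sumᶠ-cong : {n : ℕ} {f g : Fin n → ℕ} → (∀ i → f i ≡ g i) → sumᶠ f ≡ sumᶠ g
  sumᶠ-cong {zero} e = refl
  sumᶠ-cong {suc n} e = cong₂ _+_ (e fz) (sumᶠ-cong (e ∘ fs))

  countᶠ-cong : {n : ℕ} {p p′ : Fin n → Bool} → (∀ i → p i ≡ p′ i) → countᶠ p ≡ countᶠ p′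
  countᶠ-cong {zero} e = refl
  countᶠ-cong {suc n} e = cong₂ _+_ (cong 𝟙 (e fz)) (countᶠ-cong (e ∘ fs))

  count : {n : ℕ} → (ℤ → Bool) → Vec ℤ n → ℕ
  count p [] = 0
  count p (x ∷ v) = 𝟙 (p x) + count p v

  exists : {n : ℕ} → (ℤ → Bool) → Vec ℤ n → Bool
  exists p [] = false
  exists p (x ∷ v) = p x ∨ exists p v

  countPairs : {n : ℕ} → (ℤ → ℤ → Bool) → Vec ℤ n → ℕ
  countPairs R [] = 0
  countPairs R (x ∷ v) = count (R x) v + countPairs R v

  inverted : ℤ → ℤ → Bool
  inverted a b = does (b ℤ.<? a)

  negativeSum : ℤ → ℤ → Bool
  negativeSum a b = does (b ℤ.<? - a)

  negative : ℤ → Bool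
  negative a = does (a ℤ.<? ℤ.+ 0)

  exceedsAbs : ℤ → ℤ → Bool
  exceedsAbs a b = does (ℤ.+ ∣ b ∣ ℤ.<? a)

  countExceeding : {n : ℕ} → Vec ℤ n → ℕ
  countExceeding [] = 0
  countExceeding (x ∷ v) = 𝟙 (exists (exceedsAbs x) v) + countExceeding v

  countᶠ-lookup : {n : ℕ} (p : ℤ → Bool) (v : Vec ℤ n) → countᶠ (p ∘ lookup v) ≡ count p v
  countᶠ-lookup p [] = refl
  countᶠ-lookup p (x ∷ v) = cong (𝟙 (p x) +_) (countᶠ-lookup p v)

  anyᶠ-lookup : {n : ℕ} (p : ℤ → Bool) (v : Vec ℤ n) → anyᶠ (p ∘ lookup v) ≡ exists p v
  anyᶠ-lookup p [] = refl
  anyᶠ-lookup p (x ∷ v) = cong (p x ∨_) (anyᶠ-lookup p v)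

  sumᶠ-later≡countPairs : {n : ℕ} (R : ℤ → ℤ → Bool) (v : Vec ℤ n) →
    sumᶠ (λ i → countᶠ (λ j → does (toℕ i ℕ.<? toℕ j) ∧ R (lookup v i) (lookup v j))) ≡ countPairs R v
  sumᶠ-later≡countPairs R [] = refl
  sumᶠ-later≡countPairs R (x ∷ v) = cong₂ _+_ (countᶠ-lookup (R x) v) (sumᶠ-later≡countPairs R v)

  anyᶠ-later≡countExceeding : {n : ℕ} (v : Vec ℤ n) →
    countᶠ (λ i → anyᶠ (λ j → does (toℕ i ℕ.<? toℕ j) ∧ exceedsAbs (lookup v i) (lookup v j))) ≡ countExceeding v
  anyᶠ-later≡countExceeding [] = refl
  anyᶠ-later≡countExceeding (x ∷ v) =
    cong₂ (λ b k → 𝟙 b + k) (anyᶠ-lookup (exceedsAbs x) v) (anyᶠ-later≡countExceeding v)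

  negCount≡count : {n : ℕ} (w : Vec ℤ n) → negCount w ≡ count negative w
  negCount≡count {n} w = begin
    length (filter (λ i → lookup w i ℤ.<? ℤ.+ 0) (allFin n))
      ≡⟨ length-filter≡countᴸ (λ i → lookup w i ℤ.<? ℤ.+ 0) (allFin n) ⟩
    countᴸ (negative ∘ lookup w) (allFin n)
      ≡⟨ countᴸ-tabulate (negative ∘ lookup w) (λ i → i) ⟩
    countᶠ (negative ∘ lookup w)
      ≡⟨ countᶠ-lookup negative w ⟩
    count negative w ∎
    where open ≡-Reasoning

  pairCount≡countPairs : {n : ℕ} {R : ℤ → ℤ → Set} (R? : ∀ a b → Dec (R a b)) (w : Vec ℤ n) →
    pairCount (λ i j → (toℕ i ℕ.< toℕ j) × R (lookup w i) (lookup w j))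
              (λ i j → (toℕ i ℕ.<? toℕ j) ×-dec R? (lookup w i) (lookup w j))
    ≡ countPairs (λ a b → does (R? a b)) w
  pairCount≡countPairs {n} {R} R? w = begin
    length (filter later? (cartesianProduct (allFin n) (allFin n)))
      ≡⟨ length-filter≡countᴸ later? (cartesianProduct (allFin n) (allFin n)) ⟩
    countᴸ later (cartesianProduct (allFin n) (allFin n))
      ≡⟨ countᴸ-cartesianProduct later (allFin n) (allFin n) ⟩
    sum (map (λ i → countᴸ (later ∘ (i ,_)) (allFin n)) (allFin n))
      ≡⟨ sum-map-tabulate (λ i → countᴸ (later ∘ (i ,_)) (allFin n)) (λ i → i) ⟩
    sumᶠ (λ i → countᴸ (later ∘ (i ,_)) (allFin n))
      ≡⟨ sumᶠ-cong (λ i → countᴸ-tabulate (later ∘ (i ,_)) (λ j → j)) ⟩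
    sumᶠ (λ i → countᶠ (later ∘ (i ,_)))
      ≡⟨ sumᶠ-later≡countPairs (λ a b → does (R? a b)) w ⟩
    countPairs (λ a b → does (R? a b)) w ∎
    where
    open ≡-Reasoning
    Later : Fin n × Fin n → Set
    Later (i , j) = (toℕ i ℕ.< toℕ j) × R (lookup w i) (lookup w j)
    later? : (ij : Fin n × Fin n) → Dec (Later ij)
    later? (i , j) = (toℕ i ℕ.<? toℕ j) ×-dec R? (lookup w i) (lookup w j)
    later : Fin n × Fin n → Bool
    later = does ∘ later?

  invB≡ : {n : ℕ} (w : Vec ℤ n) → invB w ≡ countPairs inverted w + countPairs negativeSum w + count negative w
  invB≡ w = cong₂ _+_
    (cong₂ _+_ (pairCount≡countPairs (λ a b → b ℤ.<? a) w) (pairCount≡countPairs (λ a b → b ℤ.<? - a) w))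
    (negCount≡count w)

  mB≡ : {n : ℕ} (w : Vec ℤ n) → mB w ≡ countExceeding w + count negative w
  mB≡ {n} w = cong₂ _+_ (begin
    length (filter (λ i → any? (later? i) (allFin n)) (allFin n))
      ≡⟨ length-filter≡countᴸ (λ i → any? (later? i) (allFin n)) (allFin n) ⟩
    countᴸ (λ i → does (any? (later? i) (allFin n))) (allFin n)
      ≡⟨ countᴸ-tabulate (λ i → does (any? (later? i) (allFin n))) (λ i → i) ⟩
    countᶠ (λ i → does (any? (later? i) (allFin n)))
      ≡⟨ countᶠ-cong (λ i → trans (does-any? (later? i) (allFin n)) (any-tabulate (does ∘ later? i) (λ j → j))) ⟩
    countᶠ (λ i → anyᶠ (does ∘ later? i))
      ≡⟨ anyᶠ-later≡countExceeding w ⟩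
    countExceeding w ∎) (negCount≡count w)
    where
    open ≡-Reasoning
    later? : (i j : Fin n) → Dec ((toℕ i ℕ.< toℕ j) × (ℤ.+ ∣ lookup w j ∣ ℤ.< lookup w i))
    later? i j = (toℕ i ℕ.<? toℕ j) ×-dec (ℤ.+ ∣ lookup w j ∣ ℤ.<? lookup w i)

  count-insertAt : {m : ℕ} (p : ℤ → Bool) (v : Vec ℤ m) (i : Fin (suc m)) (y : ℤ) →
    count p (insertAt v i y) ≡ 𝟙 (p y) + count p v
  count-insertAt p v fz y = refl
  count-insertAt p (x ∷ v) (fs i) y =
    trans (cong (𝟙 (p x) +_) (count-insertAt p v i y)) (x∙yz≈y∙xz (𝟙 (p x)) (𝟙 (p y)) (count p v))

  exists-insertAt : {m : ℕ} (p : ℤ → Bool) (v : Vec ℤ m) (i : Fin (suc m)) (y : ℤ) →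
    exists p (insertAt v i y) ≡ p y ∨ exists p v
  exists-insertAt p v fz y = refl
  exists-insertAt p (x ∷ v) (fs i) y = begin
    p x ∨ exists p (insertAt v i y) ≡⟨ cong (p x ∨_) (exists-insertAt p v i y) ⟩
    p x ∨ (p y ∨ exists p v)        ≡⟨ sym (∨-assoc (p x) (p y) _) ⟩
    (p x ∨ p y) ∨ exists p v        ≡⟨ cong (_∨ exists p v) (∨-comm (p x) (p y)) ⟩
    (p y ∨ p x) ∨ exists p v        ≡⟨ ∨-assoc (p y) (p x) _ ⟩
    p y ∨ (p x ∨ exists p v)        ∎
    where open ≡-Reasoning

  count-const : {m : ℕ} (p : ℤ → Bool) (b : Bool) {v : Vec ℤ m} → All (λ a → p a ≡ b) v → count p v ≡ 𝟙 b * m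
  count-const p b [] = sym (ℕP.*-zeroʳ (𝟙 b))
  count-const p b {x ∷ v} (px ∷ pv) = trans (cong₂ _+_ (cong 𝟙 px) (count-const p b pv)) (sym (*-suc (𝟙 b) _))

  exists-const : {m : ℕ} (p : ℤ → Bool) (b : Bool) {v : Vec ℤ m} → All (λ a → p a ≡ b) v → exists p v ≡ b ∧ (0 ℕ.<ᵇ m)
  exists-const p false [] = refl
  exists-const p true [] = refl
  exists-const p false (px ∷ pv) rewrite px | exists-const p false pv = refl
  exists-const p true (px ∷ pv) rewrite px = refl

  countPairs-insertAt : {m : ℕ} (R : ℤ → ℤ → Bool) (y : ℤ) (b₁ b₂ : Bool) {v : Vec ℤ m} →
    All (λ a → R a y ≡ b₁) v → All (λ a → R y a ≡ b₂) v → (i : Fin (suc m)) →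
    countPairs R (insertAt v i y) ≡ countPairs R v + (𝟙 b₁ * toℕ i + 𝟙 b₂ * (m ∸ toℕ i))
  countPairs-insertAt {m} R y b₁ b₂ {v} _ Ry fz =
    trans (cong (_+ countPairs R v) (count-const (R y) b₂ Ry)) (shuffle (𝟙 b₁) (𝟙 b₂ * m) (countPairs R v))
    where
    shuffle : (b c P : ℕ) → c + P ≡ P + (b * 0 + c)
    shuffle = solve-∀
  countPairs-insertAt {suc m} R y b₁ b₂ {x ∷ v} (xR ∷ vR) (_ ∷ Ry) (fs i) = begin
    count (R x) (insertAt v i y) + countPairs R (insertAt v i y)
      ≡⟨ cong₂ _+_ (count-insertAt (R x) v i y) (countPairs-insertAt R y b₁ b₂ vR Ry i) ⟩
    (𝟙 (R x y) + count (R x) v) + (countPairs R v + (𝟙 b₁ * toℕ i + 𝟙 b₂ * (m ∸ toℕ i)))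
      ≡⟨ cong (λ b → (𝟙 b + count (R x) v) + (countPairs R v + (𝟙 b₁ * toℕ i + 𝟙 b₂ * (m ∸ toℕ i)))) xR ⟩
    (𝟙 b₁ + count (R x) v) + (countPairs R v + (𝟙 b₁ * toℕ i + 𝟙 b₂ * (m ∸ toℕ i)))
      ≡⟨ shuffle (𝟙 b₁) (count (R x) v) (countPairs R v) (toℕ i) (𝟙 b₂ * (m ∸ toℕ i)) ⟩
    (count (R x) v + countPairs R v) + (𝟙 b₁ * suc (toℕ i) + 𝟙 b₂ * (m ∸ toℕ i)) ∎
    where
    open ≡-Reasoning
    shuffle : (b c P i e : ℕ) → (b + c) + (P + (b * i + e)) ≡ (c + P) + (b * suc i + e)
    shuffle = solve-∀

  countExceeding-insertAt : {m : ℕ} (y : ℤ) (b : Bool) {v : Vec ℤ m} →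
    All (λ a → exceedsAbs a y ≡ false) v → All (λ a → exceedsAbs y a ≡ b) v → (i : Fin (suc m)) →
    countExceeding (insertAt v i y) ≡ countExceeding v + 𝟙 (b ∧ (toℕ i ℕ.<ᵇ m))
  countExceeding-insertAt y b {v} _ yE fz =
    trans (cong (λ e → 𝟙 e + countExceeding v) (exists-const (exceedsAbs y) b yE)) (+-comm _ (countExceeding v))
  countExceeding-insertAt {suc m} y b {x ∷ v} (xE ∷ vE) (_ ∷ yE) (fs i) = begin
    𝟙 (exists (exceedsAbs x) (insertAt v i y)) + countExceeding (insertAt v i y)
      ≡⟨ cong₂ (λ e d → 𝟙 e + d) (exists-insertAt (exceedsAbs x) v i y) (countExceeding-insertAt y b vE yE i) ⟩
    𝟙 (exceedsAbs x y ∨ exists (exceedsAbs x) v) + (countExceeding v + new)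
      ≡⟨ cong (λ e → 𝟙 (e ∨ exists (exceedsAbs x) v) + (countExceeding v + new)) xE ⟩
    𝟙 (exists (exceedsAbs x) v) + (countExceeding v + new)
      ≡⟨ sym (+-assoc _ (countExceeding v) new) ⟩
    countExceeding (x ∷ v) + new ∎
    where
    open ≡-Reasoning
    new : ℕ
    new = 𝟙 (b ∧ (toℕ i ℕ.<ᵇ m))

  ∣a∣≤B⇒a<+[1+B] : {B : ℕ} {a : ℤ} → ∣ a ∣ ℕ.≤ B → a ℤ.< ℤ.+ suc B
  ∣a∣≤B⇒a<+[1+B] {a = ℤ.+ _} a≤B = ℤ.+<+ (s≤s a≤B)
  ∣a∣≤B⇒a<+[1+B] {a = -[1+ _ ]} _ = ℤ.-<+

  ∣a∣≤B⇒-[1+B]<a : {B : ℕ} {a : ℤ} → ∣ a ∣ ℕ.≤ B → -[1+ B ] ℤ.< a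
  ∣a∣≤B⇒-[1+B]<a {a = ℤ.+ _} _ = ℤ.-<+
  ∣a∣≤B⇒-[1+B]<a {a = -[1+ _ ]} a≤B = ℤ.-<- a≤B

  module _ {B m : ℕ} {v : Vec ℤ m} (bounded : All (λ a → ∣ a ∣ ℕ.≤ B) v) where
    private
      M : ℤ
      M = ℤ.+ suc B

      everywhere : {P : ℤ → Set} → (∀ a → ∣ a ∣ ℕ.≤ B → P a) → All P v
      everywhere f = All.map (f _) bounded

      ∣-∣≤B : ∀ a → ∣ a ∣ ℕ.≤ B → ∣ - a ∣ ℕ.≤ B
      ∣-∣≤B a = subst (ℕ._≤ B) (sym (ℤP.∣-i∣≡∣i∣ a))

      P₁ P₂ N : ℕ
      P₁ = countPairs inverted v
      P₂ = countPairs negativeSum v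
      N = count negative v

    invB-insertAt-max : (i : Fin (suc m)) → invB (insertAt v i M) ≡ invB v + (m ∸ toℕ i)
    invB-insertAt-max i = begin
      invB (insertAt v i M)
        ≡⟨ invB≡ (insertAt v i M) ⟩
      countPairs inverted (insertAt v i M) + countPairs negativeSum (insertAt v i M) + count negative (insertAt v i M)
        ≡⟨ cong₂ _+_ (cong₂ _+_
             (countPairs-insertAt inverted M false true
               (everywhere λ a a≤B → dec-false (M ℤ.<? a) (ℤP.<-asym (∣a∣≤B⇒a<+[1+B] a≤B)))
               (everywhere λ a a≤B → dec-true (a ℤ.<? M) (∣a∣≤B⇒a<+[1+B] a≤B)) i)
             (countPairs-insertAt negativeSum M false false
               (everywhere λ a a≤B → dec-false (M ℤ.<? - a) (ℤP.<-asym (∣a∣≤B⇒a<+[1+B] (∣-∣≤B a a≤B))))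
               (everywhere λ a a≤B → dec-false (a ℤ.<? - M) (ℤP.<-asym (∣a∣≤B⇒-[1+B]<a a≤B))) i))
             (count-insertAt negative v i M) ⟩
      (P₁ + (0 * toℕ i + 1 * k)) + (P₂ + (0 * toℕ i + 0 * k)) + (0 + N)
        ≡⟨ arithmetic P₁ P₂ N (toℕ i) k ⟩
      (P₁ + P₂ + N) + k
        ≡⟨ cong (_+ k) (sym (invB≡ v)) ⟩
      invB v + k ∎
      where
      open ≡-Reasoning
      k : ℕ
      k = m ∸ toℕ i
      arithmetic : (P₁ P₂ N i k : ℕ) → (P₁ + (0 * i + 1 * k)) + (P₂ + (0 * i + 0 * k)) + (0 + N) ≡ (P₁ + P₂ + N) + k
      arithmetic = solve-∀

    invB-insertAt-min : (i : Fin (suc m)) → invB (insertAt v i (- M)) ≡ invB v + (suc m + toℕ i)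
    invB-insertAt-min i = begin
      invB (insertAt v i (- M))
        ≡⟨ invB≡ (insertAt v i (- M)) ⟩
      countPairs inverted (insertAt v i (- M)) + countPairs negativeSum (insertAt v i (- M))
        + count negative (insertAt v i (- M))
        ≡⟨ cong₂ _+_ (cong₂ _+_
             (countPairs-insertAt inverted (- M) true false
               (everywhere λ a a≤B → dec-true (- M ℤ.<? a) (∣a∣≤B⇒-[1+B]<a a≤B))
               (everywhere λ a a≤B → dec-false (a ℤ.<? - M) (ℤP.<-asym (∣a∣≤B⇒-[1+B]<a a≤B))) i)
             (countPairs-insertAt negativeSum (- M) true true
               (everywhere λ a a≤B → dec-true (- M ℤ.<? - a) (∣a∣≤B⇒-[1+B]<a (∣-∣≤B a a≤B)))
               (everywhere λ a a≤B → dec-true (a ℤ.<? M) (∣a∣≤B⇒a<+[1+B] a≤B)) i))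
             (count-insertAt negative v i (- M)) ⟩
      (P₁ + (1 * toℕ i + 0 * k)) + (P₂ + (1 * toℕ i + 1 * k)) + (1 + N)
        ≡⟨ arithmetic P₁ P₂ N (toℕ i) k ⟩
      (P₁ + P₂ + N) + (suc (toℕ i + k) + toℕ i)
        ≡⟨ cong₂ (λ x y → x + (suc y + toℕ i)) (sym (invB≡ v)) (ℕP.m+[n∸m]≡n (FinP.toℕ≤pred[n] i)) ⟩
      invB v + (suc m + toℕ i) ∎
      where
      open ≡-Reasoning
      k : ℕ
      k = m ∸ toℕ i
      arithmetic : (P₁ P₂ N i k : ℕ) →
        (P₁ + (1 * i + 0 * k)) + (P₂ + (1 * i + 1 * k)) + (1 + N) ≡ (P₁ + P₂ + N) + (suc (i + k) + i)
      arithmetic = solve-∀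

    mB-insertAt-max : (i : Fin (suc m)) → mB (insertAt v i M) ≡ mB v + 𝟙 (toℕ i ℕ.<ᵇ m)
    mB-insertAt-max i = begin
      mB (insertAt v i M)
        ≡⟨ mB≡ (insertAt v i M) ⟩
      countExceeding (insertAt v i M) + count negative (insertAt v i M)
        ≡⟨ cong₂ _+_
             (countExceeding-insertAt M true
               (everywhere λ a a≤B → dec-false (M ℤ.<? a) (ℤP.<-asym (∣a∣≤B⇒a<+[1+B] a≤B)))
               (everywhere λ a a≤B → dec-true (ℤ.+ ∣ a ∣ ℤ.<? M) (∣a∣≤B⇒a<+[1+B] a≤B)) i)
             (count-insertAt negative v i M) ⟩
      countExceeding v + e + (0 + N)
        ≡⟨ arithmetic e (countExceeding v) N ⟩
      countExceeding v + N + e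
        ≡⟨ cong (_+ e) (sym (mB≡ v)) ⟩
      mB v + e ∎
      where
      open ≡-Reasoning
      e : ℕ
      e = 𝟙 (toℕ i ℕ.<ᵇ m)
      arithmetic : (e D N : ℕ) → D + e + (0 + N) ≡ D + N + e
      arithmetic = solve-∀

    mB-insertAt-min : (i : Fin (suc m)) → mB (insertAt v i (- M)) ≡ mB v + 1
    mB-insertAt-min i = begin
      mB (insertAt v i (- M))
        ≡⟨ mB≡ (insertAt v i (- M)) ⟩
      countExceeding (insertAt v i (- M)) + count negative (insertAt v i (- M))
        ≡⟨ cong₂ _+_
             (countExceeding-insertAt (- M) false
               (everywhere λ a a≤B → dec-false (M ℤ.<? a) (ℤP.<-asym (∣a∣≤B⇒a<+[1+B] a≤B)))
               (everywhere λ a a≤B → dec-false (ℤ.+ ∣ a ∣ ℤ.<? - M) λ ()) i)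
             (count-insertAt negative v i (- M)) ⟩
      countExceeding v + 0 + (1 + N)
        ≡⟨ arithmetic (countExceeding v) N ⟩
      countExceeding v + N + 1
        ≡⟨ cong (_+ 1) (sym (mB≡ v)) ⟩
      mB v + 1 ∎
      where
      open ≡-Reasoning
      arithmetic : (D N : ℕ) → D + 0 + (1 + N) ≡ D + N + 1
      arithmetic = solve-∀

open Statistics

module SignedPermutations where
  open ≡ using (refl; sym; trans; cong; cong₂; subst; module ≡-Reasoning)

  data PunchInView {m : ℕ} (i : Fin (suc m)) : Fin (suc m) → Set where
    at : PunchInView i i
    punched : (j : Fin m) → PunchInView i (punchIn i j)

  punchInView : {m : ℕ} (i k : Fin (suc m)) → PunchInView i k
  punchInView i k with i FinP.≟ k
  ... | yes refl = at
  ... | no i≢k = subst (PunchInView i) (FinP.punchIn-punchOut i≢k) (punched (punchOut i≢k))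

  insertAt-isSignedPerm : {m : ℕ} (v : Vec ℤ m) → IsSignedPerm v → {y : ℤ} → ∣ y ∣ ≡ suc m → (i : Fin (suc m)) →
    IsSignedPerm (insertAt v i y)
  insertAt-isSignedPerm {m} v (range , injective) {y} ∣y∣≡1+m i = range′ , injective′
    where
    w : Vec ℤ (suc m)
    w = insertAt v i y
    ∣w-at∣ : ∣ lookup w i ∣ ≡ suc m
    ∣w-at∣ = trans (cong ∣_∣ (VecP.insertAt-lookup v i y)) ∣y∣≡1+m
    w-punched : ∀ j → lookup w (punchIn i j) ≡ lookup v j
    w-punched = VecP.insertAt-punchIn v i y
    ∣w-punched∣≢ : ∀ j → ∣ lookup w (punchIn i j) ∣ ≢ suc m
    ∣w-punched∣≢ j e = ℕP.1+n≰n (subst (ℕ._≤ m) (trans (cong ∣_∣ (sym (w-punched j))) e) (proj₂ (range j)))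
    range′ : ∀ k → (1 ℕ.≤ ∣ lookup w k ∣) × (∣ lookup w k ∣ ℕ.≤ suc m)
    range′ k with punchInView i k
    ... | at = subst (λ a → (1 ℕ.≤ a) × (a ℕ.≤ suc m)) (sym ∣w-at∣) (s≤s z≤n , ℕP.≤-refl)
    ... | punched j rewrite w-punched j = proj₁ (range j) , ℕP.m≤n⇒m≤1+n (proj₂ (range j))
    injective′ : ∀ k₁ k₂ → ∣ lookup w k₁ ∣ ≡ ∣ lookup w k₂ ∣ → k₁ ≡ k₂
    injective′ k₁ k₂ e with punchInView i k₁ | punchInView i k₂
    ... | at | at = refl
    ... | at | punched j = ⊥-elim (∣w-punched∣≢ j (trans (sym e) ∣w-at∣))
    ... | punched j | at = ⊥-elim (∣w-punched∣≢ j (trans e ∣w-at∣))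
    ... | punched j₁ | punched j₂ =
      cong (punchIn i) (injective j₁ j₂ (trans (cong ∣_∣ (sym (w-punched j₁))) (trans e (cong ∣_∣ (w-punched j₂)))))

  signed : Bool → ℕ → ℤ
  signed true n = ℤ.+ suc n
  signed false n = -[1+ n ]

  ∣signed∣ : (s : Bool) (n : ℕ) → ∣ signed s n ∣ ≡ suc n
  ∣signed∣ true n = refl
  ∣signed∣ false n = refl

  signed-injective : {s s′ : Bool} (n : ℕ) → signed s n ≡ signed s′ n → s ≡ s′
  signed-injective {true} {true} n _ = refl
  signed-injective {false} {false} n _ = refl

  signOf : {n : ℕ} (z : ℤ) → ∣ z ∣ ≡ suc n → Σ Bool (λ s → z ≡ signed s n)
  signOf (ℤ.+ suc k) e = true , cong ℤ.+_ e
  signOf -[1+ k ] e = false , cong -[1+_] (ℕP.suc-injective e)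

  -- A code records, for k = n, n - 1, …, 1, the sign of the entry ±k and its position among the entries
  -- of absolute value ≤ k.
  Code : ℕ → Set
  Code zero = ⊤
  Code (suc n) = Code n × Bool × Fin (suc n)

  decode : {n : ℕ} → Code n → Vec ℤ n
  decode {zero} _ = []
  decode {suc n} (c , s , i) = insertAt (decode c) i (signed s n)

  decode-isSignedPerm : {n : ℕ} (c : Code n) → IsSignedPerm (decode c)
  decode-isSignedPerm {zero} _ = (λ ()) , (λ ())
  decode-isSignedPerm {suc n} (c , s , i) = insertAt-isSignedPerm (decode c) (decode-isSignedPerm c) (∣signed∣ s n) i

  decode-bounded : {n : ℕ} (c : Code n) → All (λ a → ∣ a ∣ ℕ.≤ n) (decode c)
  decode-bounded c = lookup⁻ (proj₂ ∘ proj₁ (decode-isSignedPerm c))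

  decode-injective : {n : ℕ} {c c′ : Code n} → decode c ≡ decode c′ → c ≡ c′
  decode-injective {zero} _ = refl
  decode-injective {suc n} {c , s , i} {c′ , s′ , i′} e with punchInView i′ i
  ... | at = cong₂ _,_ (decode-injective same-rest) (cong₂ _,_ (signed-injective n same-entry) refl)
    where
    same-entry : signed s n ≡ signed s′ n
    same-entry = trans (sym (VecP.insertAt-lookup (decode c) i′ (signed s n)))
      (trans (cong (λ w → lookup w i′) e) (VecP.insertAt-lookup (decode c′) i′ (signed s′ n)))
    same-rest : decode c ≡ decode c′
    same-rest = trans (sym (VecP.removeAt-insertAt (decode c) i′ (signed s n)))
      (trans (cong (λ w → removeAt w i′) e) (VecP.removeAt-insertAt (decode c′) i′ (signed s′ n)))
  ... | punched j = ⊥-elim (ℕP.1+n≰n (subst (ℕ._≤ n) ∣entry∣≡1+n (lookup⁺ (decode-bounded c′) j)))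
    where
    ∣entry∣≡1+n : ∣ lookup (decode c′) j ∣ ≡ suc n
    ∣entry∣≡1+n = begin
      ∣ lookup (decode c′) j ∣
        ≡⟨ cong ∣_∣ (VecP.insertAt-punchIn (decode c′) i′ (signed s′ n) j) ⟨
      ∣ lookup (decode (c′ , s′ , i′)) (punchIn i′ j) ∣
        ≡⟨ cong (λ w → ∣ lookup w (punchIn i′ j) ∣) e ⟨
      ∣ lookup (decode (c , s , punchIn i′ j)) (punchIn i′ j) ∣
        ≡⟨ cong ∣_∣ (VecP.insertAt-lookup (decode c) (punchIn i′ j) (signed s n)) ⟩
      ∣ signed s n ∣
        ≡⟨ ∣signed∣ s n ⟩
      suc n ∎
      where open ≡-Reasoning

  -- If no entry had absolute value n + 1, then j ↦ ∣ w_j ∣ - 1 would inject Fin (n + 1) into Fin n.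
  maxEntry : {n : ℕ} (w : Vec ℤ (suc n)) → IsSignedPerm w → Σ (Fin (suc n)) (λ i → ∣ lookup w i ∣ ≡ suc n)
  maxEntry {n} w (range , injective) with FinP.any? (λ i → ∣ lookup w i ∣ ℕ.≟ suc n)
  ... | yes found = found
  ... | no none = ⊥-elim (collision (FinP.pigeonhole (ℕP.n<1+n n) index))
    where
    ∣w∣-1<n : ∀ j → ℕ.pred ∣ lookup w j ∣ ℕ.< n
    ∣w∣-1<n j with ∣ lookup w j ∣ in eq | range j
    ... | suc a | _ , a<1+n = ℕP.≤∧≢⇒< (ℕP.≤-pred a<1+n) (λ a≡n → none (j , trans eq (cong suc a≡n)))
    index : Fin (suc n) → Fin n
    index j = Fin.fromℕ< (∣w∣-1<n j)
    collision : ¬ ∃₂ (λ j₁ j₂ → j₁ Fin.< j₂ × index j₁ ≡ index j₂)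
    collision (j₁ , j₂ , j₁<j₂ , same) = FinP.<⇒≢ j₁<j₂ (injective j₁ j₂
      (ℕP.pred-injective {{ℕ.>-nonZero (proj₁ (range j₁))}} {{ℕ.>-nonZero (proj₁ (range j₂))}}
        (FinP.fromℕ<-injective _ _ (∣w∣-1<n j₁) (∣w∣-1<n j₂) same)))

  removeAt-isSignedPerm : {n : ℕ} (w : Vec ℤ (suc n)) → IsSignedPerm w → (i : Fin (suc n)) → ∣ lookup w i ∣ ≡ suc n →
    IsSignedPerm (removeAt w i)
  removeAt-isSignedPerm {n} w (range , injective) i ∣w-i∣ = range′ , injective′
    where
    w-punched : ∀ j → lookup (removeAt w i) j ≡ lookup w (punchIn i j)
    w-punched j = trans (cong (lookup (removeAt w i)) (sym (FinP.punchOut-punchIn i)))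
      (VecP.removeAt-punchOut w (FinP.punchInᵢ≢i i j ∘ sym))
    range′ : ∀ j → (1 ℕ.≤ ∣ lookup (removeAt w i) j ∣) × (∣ lookup (removeAt w i) j ∣ ℕ.≤ n)
    range′ j rewrite w-punched j =
      proj₁ (range (punchIn i j)) ,
      ℕP.≤-pred (ℕP.≤∧≢⇒< (proj₂ (range (punchIn i j))) (λ e → FinP.punchInᵢ≢i i j (injective _ _ (trans e (sym ∣w-i∣)))))
    injective′ : ∀ j k → ∣ lookup (removeAt w i) j ∣ ≡ ∣ lookup (removeAt w i) k ∣ → j ≡ k
    injective′ j k e = FinP.punchIn-injective i j k
      (injective _ _ (trans (cong ∣_∣ (sym (w-punched j))) (trans e (cong ∣_∣ (w-punched k)))))

  decode-surjective : {n : ℕ} (w : Vec ℤ n) → IsSignedPerm w → Σ (Code n) (λ c → decode c ≡ w)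
  decode-surjective {zero} [] _ = tt , refl
  decode-surjective {suc n} w σ with maxEntry w σ
  ... | i , ∣w-i∣ with signOf (lookup w i) ∣w-i∣
                     | decode-surjective (removeAt w i) (removeAt-isSignedPerm w σ i ∣w-i∣)
  ... | s , w-i≡ | c , decode-c≡ = (c , s , i) , (begin
    insertAt (decode c) i (signed s n)      ≡⟨ cong₂ (λ u y → insertAt u i y) decode-c≡ (sym w-i≡) ⟩
    insertAt (removeAt w i) i (lookup w i)  ≡⟨ VecP.insertAt-removeAt w i ⟩
    w                                       ∎)
    where open ≡-Reasoning

  choices : (n : ℕ) → List (Bool × Fin (suc n))
  choices n = cartesianProduct (true ∷ false ∷ []) (allFin (suc n))

  allCodes : (n : ℕ) → List (Code n)
  allCodes zero = tt ∷ []
  allCodes (suc n) = cartesianProduct (allCodes n) (choices n)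

  allCodes-unique : (n : ℕ) → Unique (allCodes n)
  allCodes-unique zero = [] ∷ []
  allCodes-unique (suc n) = UniqueP.cartesianProduct⁺ (allCodes-unique n)
    (UniqueP.cartesianProduct⁺ (((λ ()) ∷ []) ∷ [] ∷ []) (UniqueP.allFin⁺ (suc n)))

  ∈-allCodes : {n : ℕ} (c : Code n) → c ∈ allCodes n
  ∈-allCodes {zero} tt = here refl
  ∈-allCodes {suc n} (c , s , i) =
    ∈P.∈-cartesianProduct⁺ (∈-allCodes c) (∈P.∈-cartesianProduct⁺ (∈-bools s) (∈P.∈-allFin i))
    where
    ∈-bools : (s : Bool) → s ∈ true ∷ false ∷ []
    ∈-bools true = here refl
    ∈-bools false = there (here refl)

open SignedPermutations

module _ {c ℓ : Level} (R : CommutativeRing c ℓ) where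
  open CommutativeRing R
  open ≈-Reasoning setoid
  open import Algebra.Properties.AbelianGroup +-abelianGroup using (xyx⁻¹≈y)
  open import Algebra.Properties.CommutativeSemigroup *-commutativeSemigroup using (interchange)
  open import Tactic.RingSolver.NonReflective (fromCommutativeRing R (λ _ → nothing))
    using (_⊜_; Κ) renaming (solve to solveRing; _⊕_ to _:+_; _⊗_ to _:*_)

  private
    ∑ : List Carrier → Carrier
    ∑ = sumR R

  sumR-++ : (xs ys : List Carrier) → ∑ (xs ++ ys) ≈ ∑ xs + ∑ ys
  sumR-++ [] ys = sym (+-identityˡ _)
  sumR-++ (x ∷ xs) ys = trans (+-congˡ (sumR-++ xs ys)) (sym (+-assoc x _ _))

  sumR-↭ : {xs ys : List Carrier} → xs ↭ ys → ∑ xs ≈ ∑ ys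
  sumR-↭ p = foldr-commMonoid setoid +-isCommutativeMonoid (↭⇒↭ₛ′ isEquivalence p)

  sumR-map-cong : {A : Set} {f g : A → Carrier} → (∀ x → f x ≈ g x) → (xs : List A) → ∑ (map f xs) ≈ ∑ (map g xs)
  sumR-map-cong e [] = refl
  sumR-map-cong e (x ∷ xs) = +-cong (e x) (sumR-map-cong e xs)

  sumR-map-*ˡ : {A : Set} (a : Carrier) (f : A → Carrier) (xs : List A) → ∑ (map (λ x → a * f x) xs) ≈ a * ∑ (map f xs)
  sumR-map-*ˡ a f [] = sym (zeroʳ a)
  sumR-map-*ˡ a f (x ∷ xs) = trans (+-congˡ (sumR-map-*ˡ a f xs)) (sym (distribˡ a _ _))

  sumR-map-*ʳ : {A : Set} (a : Carrier) (f : A → Carrier) (xs : List A) → ∑ (map (λ x → f x * a) xs) ≈ ∑ (map f xs) * a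
  sumR-map-*ʳ a f xs = begin
    ∑ (map (λ x → f x * a) xs) ≈⟨ sumR-map-cong (λ x → *-comm (f x) a) xs ⟩
    ∑ (map (λ x → a * f x) xs) ≈⟨ sumR-map-*ˡ a f xs ⟩
    a * ∑ (map f xs)           ≈⟨ *-comm a _ ⟩
    ∑ (map f xs) * a           ∎

  sumR-map-cartesianProduct : {A B : Set} (h : A × B → Carrier) (xs : List A) (ys : List B) →
    ∑ (map h (cartesianProduct xs ys)) ≈ ∑ (map (λ x → ∑ (map (λ y → h (x , y)) ys)) xs)
  sumR-map-cartesianProduct h [] ys = refl
  sumR-map-cartesianProduct h (x ∷ xs) ys = begin
    ∑ (map h (map (x ,_) ys ++ cartesianProduct xs ys))
      ≈⟨ reflexive (≡.cong ∑ (ListP.map-++ h (map (x ,_) ys) (cartesianProduct xs ys))) ⟩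
    ∑ (map h (map (x ,_) ys) ++ map h (cartesianProduct xs ys))
      ≈⟨ sumR-++ (map h (map (x ,_) ys)) _ ⟩
    ∑ (map h (map (x ,_) ys)) + ∑ (map h (cartesianProduct xs ys))
      ≈⟨ +-cong (reflexive (≡.cong ∑ (≡.sym (ListP.map-∘ ys)))) (sumR-map-cartesianProduct h xs ys) ⟩
    ∑ (map (λ y → h (x , y)) ys) + ∑ (map (λ x → ∑ (map (λ y → h (x , y)) ys)) xs) ∎

  prodR-map-upTo-suc : (f : ℕ → Carrier) (n : ℕ) → prodR R (map f (upTo (suc n))) ≈ prodR R (map f (upTo n)) * f n
  prodR-map-upTo-suc f n = begin
    prodR R (map f (upTo (suc n)))                   ≡⟨ ≡.cong (prodR R ∘ map f) (ListP.upTo-∷ʳ n) ⟨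
    prodR R (map f (upTo n List.∷ʳ n))               ≡⟨ ≡.cong (prodR R) (ListP.map-++ f (upTo n) (n ∷ [])) ⟩
    prodR R (map f (upTo n) ++ f n ∷ [])             ≈⟨ prodR-++ (map f (upTo n)) (f n ∷ []) ⟩
    prodR R (map f (upTo n)) * (f n * 1#)            ≈⟨ *-congˡ (*-identityʳ (f n)) ⟩
    prodR R (map f (upTo n)) * f n                   ∎
    where
    prodR-++ : (xs ys : List Carrier) → prodR R (xs ++ ys) ≈ prodR R xs * prodR R ys
    prodR-++ [] ys = sym (*-identityˡ _)
    prodR-++ (x ∷ xs) ys = trans (*-congˡ (prodR-++ xs ys)) (sym (*-assoc x _ _))

  pow-+ : (x : Carrier) (a b : ℕ) → pow R x (a ℕ.+ b) ≈ pow R x a * pow R x b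
  pow-+ x zero b = sym (*-identityˡ _)
  pow-+ x (suc a) b = trans (*-congˡ (pow-+ x a b)) (sym (*-assoc x _ _))

  ∑< : ℕ → (ℕ → Carrier) → Carrier
  ∑< zero f = 0#
  ∑< (suc m) f = f 0 + ∑< m (f ∘ suc)

  ∑<-cong : (m : ℕ) {f g : ℕ → Carrier} → (∀ k → f k ≈ g k) → ∑< m f ≈ ∑< m g
  ∑<-cong zero e = refl
  ∑<-cong (suc m) e = +-cong (e 0) (∑<-cong m (e ∘ suc))

  ∑<-suc-last : (m : ℕ) (f : ℕ → Carrier) → ∑< (suc m) f ≈ ∑< m f + f m
  ∑<-suc-last zero f = trans (+-identityʳ (f 0)) (sym (+-identityˡ (f 0)))
  ∑<-suc-last (suc m) f = trans (+-congˡ (∑<-suc-last m (f ∘ suc))) (sym (+-assoc (f 0) _ _))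

  ∑<-+ : (a b : ℕ) (f : ℕ → Carrier) → ∑< (a ℕ.+ b) f ≈ ∑< a f + ∑< b (λ k → f (a ℕ.+ k))
  ∑<-+ zero b f = sym (+-identityˡ _)
  ∑<-+ (suc a) b f = trans (+-congˡ (∑<-+ a b (f ∘ suc))) (sym (+-assoc (f 0) _ _))

  ∑<-*ˡ : (m : ℕ) (a : Carrier) (f : ℕ → Carrier) → ∑< m (λ k → a * f k) ≈ a * ∑< m f
  ∑<-*ˡ zero a f = sym (zeroʳ a)
  ∑<-*ˡ (suc m) a f = trans (+-congˡ (∑<-*ˡ m a (f ∘ suc))) (sym (distribˡ a _ _))

  sumR-tabulate-toℕ : (m : ℕ) (f : ℕ → Carrier) → ∑ (tabulate {n = m} (f ∘ toℕ)) ≡ ∑< m f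
  sumR-tabulate-toℕ zero f = ≡.refl
  sumR-tabulate-toℕ (suc m) f = ≡.cong (f 0 +_) (sumR-tabulate-toℕ m (f ∘ suc))

  sumR-applyUpTo : (m : ℕ) (f : ℕ → Carrier) → ∑ (applyUpTo f m) ≡ ∑< m f
  sumR-applyUpTo zero f = ≡.refl
  sumR-applyUpTo (suc m) f = ≡.cong (f 0 +_) (sumR-applyUpTo m (f ∘ suc))

  sumR-map-allFin : (m : ℕ) (f : ℕ → Carrier) → ∑ (map (f ∘ toℕ) (allFin m)) ≡ ∑< m f
  sumR-map-allFin m f = ≡.trans (≡.cong ∑ (ListP.map-tabulate {n = m} (λ i → i) (f ∘ toℕ))) (sumR-tabulate-toℕ m f)

  qInt≡∑< : (q : Carrier) (m : ℕ) → qInt R q m ≡ ∑< m (pow R q)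
  qInt≡∑< q m = ≡.trans (≡.cong ∑ (ListP.map-upTo (pow R q) m)) (sumR-applyUpTo m (pow R q))

  module _ (q t : Carrier) where
    private
      q^ t^ : ℕ → Carrier
      q^ = pow R q
      t^ = pow R t

    -- The exponents are the increments of invB-insertAt-max/min and mB-insertAt-max/min.
    increment : (n : ℕ) → Bool × Fin (suc n) → Carrier
    increment n (true , i) = q^ (n ∸ toℕ i) * t^ (𝟙 (toℕ i ℕ.<ᵇ n))
    increment n (false , i) = q^ (suc n ℕ.+ toℕ i) * t^ 1

    ∑<-increment-max : (n : ℕ) →
      ∑< (suc n) (λ k → q^ (n ∸ k) * t^ (𝟙 (k ℕ.<ᵇ n))) ≈ 1# + t * ∑< n (q^ ∘ suc)
    ∑<-increment-max zero = begin
      1# * 1# + 0# ≈⟨ +-identityʳ _ ⟩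
      1# * 1#      ≈⟨ *-identityˡ 1# ⟩
      1#           ≈⟨ +-identityʳ 1# ⟨
      1# + 0#      ≈⟨ +-congˡ (zeroʳ t) ⟨
      1# + t * 0#  ∎
    ∑<-increment-max (suc n) = begin
      q^ (suc n) * (t * 1#) + ∑< (suc n) (λ k → q^ (n ∸ k) * t^ (𝟙 (k ℕ.<ᵇ n)))
        ≈⟨ +-cong (*-congˡ (*-identityʳ t)) (∑<-increment-max n) ⟩
      q^ (suc n) * t + (1# + t * ∑< n (q^ ∘ suc))
        ≈⟨ regroup (q^ (suc n)) t (∑< n (q^ ∘ suc)) ⟩
      1# + t * (∑< n (q^ ∘ suc) + q^ (suc n))
        ≈⟨ +-congˡ (*-congˡ (∑<-suc-last n (q^ ∘ suc))) ⟨
      1# + t * ∑< (suc n) (q^ ∘ suc) ∎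
      where
      regroup : ∀ a t x → a * t + (1# + t * x) ≈ 1# + t * (x + a)
      regroup = solveRing 3 (λ a t x → ((a :* t) :+ (Κ 1# :+ (t :* x))) ⊜ (Κ 1# :+ (t :* (x :+ a)))) refl

    ∑<-increment-min : (n : ℕ) → ∑< (suc n) (λ k → q^ (suc n ℕ.+ k) * t^ 1) ≈ t * ∑< (suc n) (λ k → q^ (suc n ℕ.+ k))
    ∑<-increment-min n = begin
      ∑< (suc n) (λ k → q^ (suc n ℕ.+ k) * t^ 1)
        ≈⟨ ∑<-cong (suc n) (λ k → trans (*-comm (q^ (suc n ℕ.+ k)) (t * 1#)) (*-congʳ (*-identityʳ t))) ⟩
      ∑< (suc n) (λ k → t * q^ (suc n ℕ.+ k))
        ≈⟨ ∑<-*ˡ (suc n) t (λ k → q^ (suc n ℕ.+ k)) ⟩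
      t * ∑< (suc n) (λ k → q^ (suc n ℕ.+ k)) ∎

    qInt-2[1+n] : (n : ℕ) → qInt R q (2 ℕ.* suc n) ≈ (1# + ∑< n (q^ ∘ suc)) + ∑< (suc n) (λ k → q^ (suc n ℕ.+ k))
    qInt-2[1+n] n = begin
      qInt R q (2 ℕ.* suc n)       ≡⟨ qInt≡∑< q (2 ℕ.* suc n) ⟩
      ∑< (2 ℕ.* suc n) q^          ≡⟨ ≡.cong (λ m → ∑< (suc n ℕ.+ m) q^) (ℕP.+-identityʳ (suc n)) ⟩
      ∑< (suc n ℕ.+ suc n) q^      ≈⟨ ∑<-+ (suc n) (suc n) q^ ⟩
      (1# + ∑< n (q^ ∘ suc)) + ∑< (suc n) (λ k → q^ (suc n ℕ.+ k)) ∎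

    ∑-increment : (n : ℕ) → ∑ (map (increment n) (choices n)) ≈ (1# + t * qInt R q (2 ℕ.* suc n)) - t
    ∑-increment n = begin
      ∑ (map (increment n) (choices n))
        ≈⟨ sumR-map-cartesianProduct (increment n) (true ∷ false ∷ []) (allFin (suc n)) ⟩
      ∑ (map (increment n ∘ (true ,_)) (allFin (suc n))) + (∑ (map (increment n ∘ (false ,_)) (allFin (suc n))) + 0#)
        ≈⟨ +-cong (reflexive (sumR-map-allFin (suc n) (λ k → q^ (n ∸ k) * t^ (𝟙 (k ℕ.<ᵇ n)))))
                  (trans (+-identityʳ _) (reflexive (sumR-map-allFin (suc n) (λ k → q^ (suc n ℕ.+ k) * t^ 1)))) ⟩
      ∑< (suc n) (λ k → q^ (n ∸ k) * t^ (𝟙 (k ℕ.<ᵇ n))) + ∑< (suc n) (λ k → q^ (suc n ℕ.+ k) * t^ 1)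
        ≈⟨ +-cong (∑<-increment-max n) (∑<-increment-min n) ⟩
      (1# + t * X) + t * Y
        ≈⟨ xyx⁻¹≈y t _ ⟨
      (t + ((1# + t * X) + t * Y)) - t
        ≈⟨ +-congʳ (trans (regroup 1# t X Y) (+-congʳ (*-identityʳ t))) ⟨
      (1# + t * ((1# + X) + Y)) - t
        ≈⟨ +-congʳ (+-congˡ (*-congˡ (qInt-2[1+n] n))) ⟨
      (1# + t * qInt R q (2 ℕ.* suc n)) - t ∎
      where
      X Y : Carrier
      X = ∑< n (q^ ∘ suc)
      Y = ∑< (suc n) (λ k → q^ (suc n ℕ.+ k))
      regroup : ∀ o t x y → o + t * ((o + x) + y) ≈ t * o + ((o + t * x) + t * y)
      regroup = solveRing 4
        (λ o t x y → (o :+ (t :* ((o :+ x) :+ y))) ⊜ ((t :* o) :+ ((o :+ (t :* x)) :+ (t :* y)))) refl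

    weight : {n : ℕ} → Vec ℤ n → Carrier
    weight w = q^ (invB w) * t^ (mB w)

    weight-+ : {m m′ : ℕ} (w : Vec ℤ m) (w′ : Vec ℤ m′) {a b : ℕ} →
      invB w′ ≡ invB w ℕ.+ a → mB w′ ≡ mB w ℕ.+ b → weight w′ ≈ weight w * (q^ a * t^ b)
    weight-+ w w′ {a} {b} invB≡ mB≡ = begin
      q^ (invB w′) * t^ (mB w′)                       ≡⟨ ≡.cong₂ (λ x y → q^ x * t^ y) invB≡ mB≡ ⟩
      q^ (invB w ℕ.+ a) * t^ (mB w ℕ.+ b)              ≈⟨ *-cong (pow-+ q (invB w) a) (pow-+ t (mB w) b) ⟩
      (q^ (invB w) * q^ a) * (t^ (mB w) * t^ b)       ≈⟨ interchange (q^ (invB w)) (q^ a) (t^ (mB w)) (t^ b) ⟩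
      (q^ (invB w) * t^ (mB w)) * (q^ a * t^ b)       ∎

    weight-decode : (n : ℕ) (c : Code n) (s : Bool) (i : Fin (suc n)) →
      weight (decode (c , s , i)) ≈ weight (decode c) * increment n (s , i)
    weight-decode n c true i = weight-+ (decode c) (decode (c , true , i))
      (invB-insertAt-max (decode-bounded c) i) (mB-insertAt-max (decode-bounded c) i)
    weight-decode n c false i = weight-+ (decode c) (decode (c , false , i))
      (invB-insertAt-min (decode-bounded c) i) (mB-insertAt-min (decode-bounded c) i)

    sumR-weight-decode-suc : (n : ℕ) →
      ∑ (map (weight ∘ decode) (allCodes (suc n)))
        ≈ ∑ (map (weight ∘ decode) (allCodes n)) * ∑ (map (increment n) (choices n))
    sumR-weight-decode-suc n = begin
      ∑ (map (weight ∘ decode) (cartesianProduct (allCodes n) (choices n)))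
        ≈⟨ sumR-map-cartesianProduct (weight ∘ decode) (allCodes n) (choices n) ⟩
      ∑ (map (λ c → ∑ (map (λ si → weight (decode (c , si))) (choices n))) (allCodes n))
        ≈⟨ sumR-map-cong (λ c → sumR-map-cong (λ (s , i) → weight-decode n c s i) (choices n)) (allCodes n) ⟩
      ∑ (map (λ c → ∑ (map (λ si → weight (decode c) * increment n si) (choices n))) (allCodes n))
        ≈⟨ sumR-map-cong (λ c → sumR-map-*ˡ (weight (decode c)) (increment n) (choices n)) (allCodes n) ⟩
      ∑ (map (λ c → weight (decode c) * ∑ (map (increment n) (choices n))) (allCodes n))
        ≈⟨ sumR-map-*ʳ (∑ (map (increment n) (choices n))) (weight ∘ decode) (allCodes n) ⟩
      ∑ (map (weight ∘ decode) (allCodes n)) * ∑ (map (increment n) (choices n)) ∎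

    sumR-weight-decode≈Bpoly : (n : ℕ) → ∑ (map (weight ∘ decode) (allCodes n)) ≈ Bpoly R n q t
    sumR-weight-decode≈Bpoly zero = trans (+-identityʳ _) (*-identityˡ 1#)
    sumR-weight-decode≈Bpoly (suc n) = begin
      ∑ (map (weight ∘ decode) (allCodes (suc n)))
        ≈⟨ sumR-weight-decode-suc n ⟩
      ∑ (map (weight ∘ decode) (allCodes n)) * ∑ (map (increment n) (choices n))
        ≈⟨ *-cong (sumR-weight-decode≈Bpoly n) (∑-increment n) ⟩
      Bpoly R n q t * ((1# + t * qInt R q (2 ℕ.* suc n)) - t)
        ≈⟨ prodR-map-upTo-suc (λ i → (1# + t * qInt R q (2 ℕ.* suc i)) - t) n ⟨
      Bpoly R (suc n) q t ∎

signedPerms↭decode-allCodes : {n : ℕ} (Bn : List (Vec ℤ n)) → Unique Bn → ((w : Vec ℤ n) → (w ∈ Bn ⇔ IsSignedPerm w)) →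
  Bn ↭ map decode (allCodes n)
signedPerms↭decode-allCodes {n} Bn unique members =
  ∼bag⇒↭ (unique∧set⇒bag unique (UniqueP.map⁺ decode-injective (allCodes-unique n)) (mk⇔ to from))
  where
  to : ∀ {w} → w ∈ Bn → w ∈ map decode (allCodes n)
  to {w} w∈Bn with decode-surjective w (Equivalence.to (members w) w∈Bn)
  ... | c , ≡.refl = ∈P.∈-map⁺ decode (∈-allCodes c)
  from : ∀ {w} → w ∈ map decode (allCodes n) → w ∈ Bn
  from w∈ with ∈P.∈-map⁻ decode w∈
  ... | c , _ , ≡.refl = Equivalence.from (members (decode c)) (decode-isSignedPerm c)

corollary3p2 : {c ℓ : Level} (R : CommutativeRing c ℓ) (n : ℕ) → n ≥ 1 →
    (Bn : List (Vec ℤ n)) → Unique Bn → ((w : Vec ℤ n) → (w ∈ Bn ⇔ IsSignedPerm w)) →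
    (q t : CommutativeRing.Carrier R) →
    CommutativeRing._≈_ R (Bpoly R n q t)
      (sumR R (map (λ w → CommutativeRing._*_ R (pow R q (invB w)) (pow R t (mB w))) Bn))
corollary3p2 R n _ Bn unique members q t = begin
  Bpoly R n q t                                     ≈⟨ sumR-weight-decode≈Bpoly R q t n ⟨
  sumR R (map (weight R q t ∘ decode) (allCodes n)) ≡⟨ ≡.cong (sumR R) (ListP.map-∘ (allCodes n)) ⟩
  sumR R (map (weight R q t) (map decode (allCodes n)))
    ≈⟨ sumR-↭ R (↭P.map⁺ (weight R q t) (↭-sym (signedPerms↭decode-allCodes Bn unique members))) ⟩
  sumR R (map (weight R q t) Bn)                    ∎
  where open ≈-Reasoning (CommutativeRing.setoid R)
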